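{- Let $S\subseteq\{1,2,3\}$ with $2\in S$. Then $\mathfrak{E}^S_{n+1}$ is feebly representable for all integers $n\geq 2$.
   Context: Let $C=\{c_1,\dots,c_n\}$ and $C^+=\{1'\}\cup C$. The chromatic algebra $\mathfrak{E}^S_{n+1}$: a triple $(x,y,z)\in (C^+)^3$ is consistent if either one of $x,y,z$ equals $1'$ and the other two are equal, or $x,y,z\in C$ and $|\{x,y,z\}|\in S$. The algebra has universe the power set of $C^+$, set-theoretic Boolean operations ($0=\varnothing$, $1=C^+$), identity $\{1'\}$, converse the identity map, and composition $X;Y=\{z:(x,y,z)\text{ consistent for some }x\in X,y\in Y\}$; $\leq$ is inclusion. A feeble representation of $\mathbf A$ on a set $U$ is an injective Boolean algebra homomorphism $\varphi$ from $\mathbf A$ into the power set of $U\times U$ with $\varphi(0)=\varnothing$, $\varphi(1)=U\times U$, $\varphi(1')=\mathrm{Id}_U$, $\varphi(\breve x)=\varphi(x)^{\smile}$, and $\varphi(x)\circ\varphi(y)\subseteq\varphi(x;y)$ for all $x,y$ ($\circ$ relational composition). -}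

module Defs where

open import Data.Nat using (ℕ; zero; suc)
open import Data.Bool using (Bool; true; false; _∧_; _∨_; not; if_then_else_)
open import Data.Fin using (Fin; zero; suc; _≟_)
open import Data.Fin.Subset using (Subset; _∪_; _∩_; ∁; ⊥; ⊤; ⁅_⁆)
open import Data.Vec using (lookup; tabulate)
open import Data.Product using (Σ; _×_)
open import Relation.Nullary.Decidable using (⌊_⌋)
open import Relation.Binary.PropositionalEquality using (_≡_)
open import Function.Bundles using (_⇔_)

-- Convention: C⁺ = Fin (suc n); the element `zero` is the identity atom 1',
-- and `suc i` (i : Fin n) are the colours c_1,…,c_n.
Atom : ℕ → Set
Atom n = Fin (suc n)

one' : ∀ {n} → Atom n
one' = zero

isOne' : ∀ {n} → Atom n → Bool
isOne' zero    = true
isOne' (suc _) = false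

_==_ : ∀ {m} → Fin m → Fin m → Bool
x == y = ⌊ x ≟ y ⌋

anyFin : ∀ {m} → (Fin m → Bool) → Bool
anyFin {zero}  f = false
anyFin {suc m} f = f zero ∨ anyFin (λ i → f (suc i))

-- S ⊆ {1,2,3} is given as a subset of Fin 3, where index k represents the
-- number k+1.  `k ∈ₛ S` decides membership of the natural number k in S.
_∈ₛ_ : ℕ → Subset 3 → Bool
1 ∈ₛ S = lookup S zero
2 ∈ₛ S = lookup S (suc zero)
3 ∈ₛ S = lookup S (suc (suc zero))
_ ∈ₛ S = false

card3 : ∀ {m} → Fin m → Fin m → Fin m → ℕ
card3 x y z =
  if (x == y) ∧ (y == z) then 1
  else if (x == y) ∨ (y == z) ∨ (x == z) then 2
  else 3

consistent : ∀ {n} → Subset 3 → Atom n → Atom n → Atom n → Bool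
consistent S x y z =
     (isOne' x ∧ (y == z))
  ∨ (isOne' y ∧ (x == z))
  ∨ (isOne' z ∧ (x == y))
  ∨ (not (isOne' x) ∧ not (isOne' y) ∧ not (isOne' z) ∧ (card3 x y z ∈ₛ S))

-- The chromatic algebra 𝔈^S_{n+1}: universe = subsets of C⁺ (Subset (suc n)),
-- Boolean operations from Data.Fin.Subset, identity ⁅ one' ⁆, converse = id,
-- and the composition below.
Elem : ℕ → Set
Elem n = Subset (suc n)

idE : ∀ {n} → Elem n
idE = ⁅ one' ⁆

conv : ∀ {n} → Elem n → Elem n
conv X = X

compose : ∀ {n} → Subset 3 → Elem n → Elem n → Elem n
compose S X Y = tabulate λ z →
  anyFin λ x → anyFin λ y → lookup X x ∧ lookup Y y ∧ consistent S x y z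

Rel₂ : Set → Set
Rel₂ U = U → U → Bool

record FeebleRep (S : Subset 3) (n : ℕ) (U : Set) : Set where
  field
    φ         : Elem n → Rel₂ U
    injective : ∀ X Y → (∀ u v → φ X u v ≡ φ Y u v) → X ≡ Y
    hom-∪     : ∀ X Y u v → φ (X ∪ Y) u v ≡ (φ X u v ∨ φ Y u v)
    hom-∩     : ∀ X Y u v → φ (X ∩ Y) u v ≡ (φ X u v ∧ φ Y u v)
    hom-∁     : ∀ X u v → φ (∁ X) u v ≡ not (φ X u v)
    hom-0     : ∀ u v → φ ⊥ u v ≡ false
    hom-1     : ∀ u v → φ ⊤ u v ≡ true
    hom-id    : ∀ u v → (φ idE u v ≡ true) ⇔ (u ≡ v)
    hom-conv  : ∀ X u v → φ (conv X) u v ≡ φ X v u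
    hom-comp  : ∀ X Y u w v → φ X u w ≡ true → φ Y w v ≡ true
                → φ (compose S X Y) u v ≡ true

FeeblyRepresentable : Subset 3 → ℕ → Set₁
FeeblyRepresentable S n = Σ Set λ U → FeebleRep S n U

-- Represent 𝔈^S_{n+1} on U = {0,…,n} by colouring each edge {u,v}, u ≠ v, with c_{min(u,v)+1}
-- and each loop with 1', and letting X act as the set of pairs whose colour lies in X.
-- A triangle u < w < v then has colours c_{u+1}, c_{w+1}, c_{u+1}: exactly two colours,
-- so it is consistent as soon as 2 ∈ S; every colour is used, which makes the map injective.
module Submission where

open import Defs
open import Data.Nat using (ℕ; _≥_)
open import Data.Bool using (Bool; true; false; _∧_; _∨_; not)
open import Data.Bool.Properties using (∨-zeroʳ)
open import Data.Fin using (Fin; zero; suc; _≟_)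
open import Data.Fin.Subset using (Subset)
open import Data.Fin.Subset.Properties using (x∈⁅y⁆⇒x≡y)
open import Data.Vec using (Vec; lookup; tabulate)
open import Data.Vec.Properties
  using (lookup-map; lookup-zipWith; lookup-replicate; lookup∘tabulate; tabulate∘lookup;
         tabulate-cong; lookup⇒[]=)
open import Data.Product using (∃₂; _,_)
open import Relation.Nullary using (yes; no)
open import Relation.Binary.PropositionalEquality using (_≡_; refl; sym; trans; cong; module ≡-Reasoning)
open import Function.Bundles using (mk⇔)

lookup-injective : ∀ {A : Set} {m} (X Y : Vec A m) → (∀ i → lookup X i ≡ lookup Y i) → X ≡ Y
lookup-injective X Y X≗Y = begin
  X                   ≡⟨ sym (tabulate∘lookup X) ⟩
  tabulate (lookup X) ≡⟨ tabulate-cong X≗Y ⟩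
  tabulate (lookup Y) ≡⟨ tabulate∘lookup Y ⟩
  Y                   ∎
  where open ≡-Reasoning

∧-true : ∀ {a b : Bool} → a ≡ true → b ≡ true → (a ∧ b) ≡ true
∧-true refl refl = refl

anyFin-witness : ∀ {m} (f : Fin m → Bool) (i : Fin m) → f i ≡ true → anyFin f ≡ true
anyFin-witness f zero    fi rewrite fi = refl
anyFin-witness f (suc i) fi =
  trans (cong (f zero ∨_) (anyFin-witness (λ k → f (suc k)) i fi)) (∨-zeroʳ (f zero))

compose-intro : ∀ {n} S (X Y : Elem n) {x y z} →
  lookup X x ≡ true → lookup Y y ≡ true → consistent S x y z ≡ true →
  lookup (compose S X Y) z ≡ true
compose-intro {n} S X Y {x} {y} {z} x∈X y∈Y xyz =
  trans (lookup∘tabulate (λ z′ → anyFin λ x′ → anyFin λ y′ → triple x′ y′ z′) z)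
    (anyFin-witness (λ x′ → anyFin λ y′ → triple x′ y′ z) x
      (anyFin-witness (λ y′ → triple x y′ z) y (∧-true x∈X (∧-true y∈Y xyz))))
  where
  triple : Atom n → Atom n → Atom n → Bool
  triple x′ y′ z′ = lookup X x′ ∧ lookup Y y′ ∧ consistent S x′ y′ z′

∈idE⇒≡one' : ∀ {n} (a : Atom n) → lookup idE a ≡ true → a ≡ one'
∈idE⇒≡one' a a∈idE = x∈⁅y⁆⇒x≡y zero (lookup⇒[]= a idE a∈idE)

record ConsistentColouring (S : Subset 3) (n : ℕ) (U : Set) : Set where
  field
    colour             : U → U → Atom n
    colour-surjective  : ∀ a → ∃₂ λ u v → colour u v ≡ a
    colour-sym         : ∀ u v → colour u v ≡ colour v u
    colour-diag        : ∀ u → colour u u ≡ one'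
    colour-one'⇒≡      : ∀ u v → colour u v ≡ one' → u ≡ v
    colour-consistent  : ∀ u w v → consistent S (colour u w) (colour w v) (colour u v) ≡ true

colouring⇒feebleRep : ∀ {S n U} → ConsistentColouring S n U → FeebleRep S n U
colouring⇒feebleRep {S} c = record
  { φ         = φ
  ; injective = λ X Y φX≗φY → lookup-injective X Y λ a →
      let (u , v , uv≡a) = colour-surjective a
      in trans (cong (lookup X) (sym uv≡a)) (trans (φX≗φY u v) (cong (lookup Y) uv≡a))
  ; hom-∪     = λ X Y u v → lookup-zipWith _∨_ (colour u v) X Y
  ; hom-∩     = λ X Y u v → lookup-zipWith _∧_ (colour u v) X Y
  ; hom-∁     = λ X u v → lookup-map (colour u v) not X
  ; hom-0     = λ u v → lookup-replicate (colour u v) false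
  ; hom-1     = λ u v → lookup-replicate (colour u v) true
  ; hom-id    = λ u v → mk⇔ (λ uv∈idE → colour-one'⇒≡ u v (∈idE⇒≡one' (colour u v) uv∈idE))
                             (λ { refl → cong (lookup idE) (colour-diag u) })
  ; hom-conv  = λ X u v → cong (lookup X) (colour-sym u v)
  ; hom-comp  = λ X Y u w v uw∈X wv∈Y →
      compose-intro S X Y uw∈X wv∈Y (colour-consistent u w v)
  }
  where
  open ConsistentColouring c

  φ : Elem _ → Rel₂ _
  φ X u v = lookup X (colour u v)

shift : ∀ {m} → Atom m → Atom (ℕ.suc m)
shift zero    = zero
shift (suc c) = suc (suc c)

isOne'-shift : ∀ {m} (a : Atom m) → isOne' (shift a) ≡ isOne' a
isOne'-shift zero    = refl
isOne'-shift (suc a) = refl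

==-shift : ∀ {m} (a b : Atom m) → (shift a == shift b) ≡ (a == b)
==-shift zero    zero    = refl
==-shift zero    (suc b) = refl
==-shift (suc a) zero    = refl
==-shift (suc a) (suc b) with a ≟ b
... | yes _ = refl
... | no  _ = refl

consistent-shift : ∀ {m} S (a b c : Atom m) →
  consistent S (shift a) (shift b) (shift c) ≡ consistent S a b c
consistent-shift S a b c
  rewrite isOne'-shift a | isOne'-shift b | isOne'-shift c
        | ==-shift a b | ==-shift b c | ==-shift a c = refl

minColour : ∀ {n} → Fin (ℕ.suc n) → Fin (ℕ.suc n) → Atom n
minColour zero zero = zero
minColour {ℕ.suc _} zero    (suc _) = suc zero
minColour {ℕ.suc _} (suc _) zero    = suc zero
minColour {ℕ.suc _} (suc i) (suc j) = shift (minColour i j)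

minColour-surjective : ∀ {n} (a : Atom n) → ∃₂ λ u v → minColour u v ≡ a
minColour-surjective zero = zero , zero , refl
minColour-surjective {ℕ.suc _} (suc zero) = zero , suc zero , refl
minColour-surjective {ℕ.suc _} (suc (suc c)) =
  let (i , j , ij≡c) = minColour-surjective (suc c) in suc i , suc j , cong shift ij≡c

minColour-sym : ∀ {n} (u v : Fin (ℕ.suc n)) → minColour u v ≡ minColour v u
minColour-sym zero zero = refl
minColour-sym {ℕ.suc _} zero    (suc _) = refl
minColour-sym {ℕ.suc _} (suc _) zero    = refl
minColour-sym {ℕ.suc _} (suc i) (suc j) = cong shift (minColour-sym i j)

minColour-diag : ∀ {n} (u : Fin (ℕ.suc n)) → minColour u u ≡ one'
minColour-diag zero = refl
minColour-diag {ℕ.suc _} (suc i) = cong shift (minColour-diag i)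

minColour-one'⇒≡ : ∀ {n} (u v : Fin (ℕ.suc n)) → minColour u v ≡ one' → u ≡ v
minColour-one'⇒≡ zero zero _ = refl
minColour-one'⇒≡ {ℕ.suc _} zero    (suc _) ()
minColour-one'⇒≡ {ℕ.suc _} (suc _) zero    ()
minColour-one'⇒≡ {ℕ.suc _} (suc i) (suc j) ij≡one' with minColour i j in eq
minColour-one'⇒≡ {ℕ.suc _} (suc i) (suc j) refl    | zero = cong suc (minColour-one'⇒≡ i j eq)

-- In the cases with exactly one vertex 0, the triangle has colours c₁, c₁ and either 1' or c_k, k ≥ 2.
minColour-consistent : ∀ S → (2 ∈ₛ S) ≡ true → ∀ {n} (u w v : Fin (ℕ.suc n)) →
  consistent S (minColour u w) (minColour w v) (minColour u v) ≡ true
minColour-consistent S 2∈S zero zero zero = refl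
minColour-consistent S 2∈S {ℕ.suc _} zero    zero    (suc _) = refl
minColour-consistent S 2∈S {ℕ.suc _} zero    (suc _) zero    = refl
minColour-consistent S 2∈S {ℕ.suc _} (suc _) zero    zero    = refl
minColour-consistent S 2∈S {ℕ.suc _} zero (suc j) (suc k) with minColour j k
... | zero  = refl
... | suc _ = 2∈S
minColour-consistent S 2∈S {ℕ.suc _} (suc i) zero (suc k) with minColour i k
... | zero  = refl
... | suc _ = 2∈S
minColour-consistent S 2∈S {ℕ.suc _} (suc i) (suc j) zero with minColour i j
... | zero  = refl
... | suc _ = 2∈S
minColour-consistent S 2∈S {ℕ.suc _} (suc i) (suc j) (suc k) =
  trans (consistent-shift S (minColour i j) (minColour j k) (minColour i k))
        (minColour-consistent S 2∈S i j k)

minColouring : ∀ S → (2 ∈ₛ S) ≡ true → ∀ n → ConsistentColouring S n (Fin (ℕ.suc n))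
minColouring S 2∈S n = record
  { colour            = minColour
  ; colour-surjective = minColour-surjective
  ; colour-sym        = minColour-sym
  ; colour-diag       = minColour-diag
  ; colour-one'⇒≡     = minColour-one'⇒≡
  ; colour-consistent = minColour-consistent S 2∈S
  }

-- The construction works for every n.
mainTheorem7 : (S : Subset 3) → (2 ∈ₛ S) ≡ true → (n : ℕ) → n ≥ 2 → FeeblyRepresentable S n
mainTheorem7 S 2∈S n _ = Fin (ℕ.suc n) , colouring⇒feebleRep (minColouring S 2∈S n)
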